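{- Let $n\ge 1$ be an integer and let $A\subseteq\mathbb{Z}_5^n$ be a sum-free subset with $|A|>\frac32\cdot5^{n-1}$. If $H<\mathbb{Z}_5^n$ is a maximal proper subgroup such that every $H$-coset contains fewer than $\frac12|H|$ elements of $A$, then there is at most one $H$-coset containing more than $\frac25|H|$ elements of $A$.
   Context: $\mathbb{Z}_5^n$ denotes the elementary abelian $5$-group of rank $n$. A subset $S$ of an abelian group is sum-free if there are no $x,y,z\in S$ (not necessarily distinct) with $x+y=z$. -}

module Defs where

open import Data.Nat using (ℕ; zero; suc; _+_; _*_; _^_; _<_)
open import Data.Nat.DivMod using (_mod_)
open import Data.Fin using (Fin; toℕ)
import Data.Fin
import Data.Vec
open import Data.Vec using (Vec; []; _∷_; zipWith; replicate)
open import Data.List using (List; []; _∷_; map; concatMap; length; filter; allFin)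
open import Data.Bool using (Bool; true; false; _∧_; T)
open import Data.Bool.Properties using (T?)
open import Data.Product using (Σ; _×_; ∃)
open import Data.Sum using (_⊎_)
open import Relation.Binary.PropositionalEquality using (_≡_)

Z5^ : ℕ → Set
Z5^ n = Vec (Fin 5) n

_⊕₅_ : Fin 5 → Fin 5 → Fin 5
a ⊕₅ b = (toℕ a + toℕ b) mod 5

-- negation mod 5 (4·a = -a)
neg₅ : Fin 5 → Fin 5
neg₅ a = (4 * toℕ a) mod 5

_⊕_ : ∀ {n} → Z5^ n → Z5^ n → Z5^ n
_⊕_ = zipWith _⊕₅_

⊖_ : ∀ {n} → Z5^ n → Z5^ n
⊖_ = Data.Vec.map neg₅

𝟘 : ∀ {n} → Z5^ n
𝟘 {n} = replicate n Data.Fin.zero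

elems : (n : ℕ) → List (Z5^ n)
elems zero = [] ∷ []
elems (suc n) = concatMap (λ a → map (a ∷_) (elems n)) (allFin 5)

Subset : ℕ → Set
Subset n = Z5^ n → Bool

_∈ₛ_ : ∀ {n} → Z5^ n → Subset n → Set
x ∈ₛ S = S x ≡ true

card : ∀ {n} → Subset n → ℕ
card {n} S = length (filter (λ x → T? (S x)) (elems n))

cosetCount : ∀ {n} → Subset n → Subset n → Z5^ n → ℕ
cosetCount {n} A H x = length (filter (λ h → T? (H h ∧ A (x ⊕ h))) (elems n))

SumFree : ∀ {n} → Subset n → Set
SumFree {n} A = (x y : Z5^ n) → x ∈ₛ A → y ∈ₛ A → A (x ⊕ y) ≡ false

IsSubgroup : ∀ {n} → Subset n → Set
IsSubgroup {n} H =
  (𝟘 ∈ₛ H) ×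
  ((x y : Z5^ n) → x ∈ₛ H → y ∈ₛ H → (x ⊕ y) ∈ₛ H) ×
  ((x : Z5^ n) → x ∈ₛ H → (⊖ x) ∈ₛ H)

IsMaximalProperSubgroup : ∀ {n} → Subset n → Set
IsMaximalProperSubgroup {n} H =
  IsSubgroup H ×
  (Σ (Z5^ n) λ x → H x ≡ false) ×
  ((K : Subset n) → IsSubgroup K → ((x : Z5^ n) → x ∈ₛ H → x ∈ₛ K) →
     ((x : Z5^ n) → K x ≡ H x) ⊎ ((x : Z5^ n) → x ∈ₛ K))

SameCoset : ∀ {n} → Subset n → Z5^ n → Z5^ n → Set
SameCoset {n} H x y = Σ (Z5^ n) λ h → (h ∈ₛ H) × (y ≡ x ⊕ h)

-- Write the cosets of H as k·d + H (k < 5) for some d ∉ H, so that |H| = 5^m, and let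
-- a k = |A ∩ (k·d + H)|.  Translating these slices into H, sum-freeness says that
-- Aᵢ + Aⱼ misses Aᵢ₊ⱼ.  A Hamidoune-type isoperimetric argument shows that if
-- W ⊆ H has |W| > 2|H|/5, then every nonempty C ⊆ H with C + W ≠ H satisfies
-- |C + W| ≥ |C| + 2|H|/5: among such C, one minimising |C + W| - |C| (and then |C|)
-- and containing 0 is closed under addition, hence a subgroup, and a proper subgroup
-- of a group of order 5^m has index at least 5.  With W = -Aⱼ and C = Aᵢ₊ⱼ this
-- gives a i + a (i + j) ≤ 3|H|/5 whenever a i, a j > 2|H|/5.  If the cosets p·d + H and
-- (p+1)·d + H both had more than 2|H|/5 elements of A, these bounds for suitable i, j
-- (together with |A| > 3|H|/2 when p = 2) would be contradictory.

module Submission where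

open import Defs
import Algebra.Properties.AbelianGroup
import Algebra.Properties.CommutativeMonoid.Sum as CommutativeMonoidSum
import Algebra.Properties.CommutativeSemigroup
import Algebra.Properties.Monoid.Mult
open import Algebra.Bundles using (AbelianGroup)
open import Algebra.Structures using (IsAbelianGroup)
open import Data.Bool using (Bool; true; false; _∧_; _∨_; not)
open import Data.Bool.ListAction using (any)
open import Data.Bool.Properties using (T?; ∧-comm; ∧-zeroʳ; ∨-zeroʳ; ∧-conicalˡ; ∧-conicalʳ)
open import Data.Empty using (⊥; ⊥-elim)
open import Data.Fin using (Fin; zero; suc)
open import Data.Fin.Permutation using (Permutation′; permutation; _⟨$⟩ʳ_)
open import Data.Fin.Properties using (all?; _≟_)
open import Data.List using (List; []; _∷_; _++_; map; concat; length; filter; allFin; upTo)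
open import Data.List.Membership.Propositional using (_∈_)
open import Data.List.Membership.Propositional.Properties using (∈-concat⁺′; ∈-map⁺; ∈-allFin; ∈-upTo⁺)
open import Data.List.Relation.Unary.Any using (here; there)
open import Data.Nat using (ℕ; zero; suc; _+_; _*_; _∸_; _^_; _%_; _/_; _≤_; _<_; _≰_; z≤n; s≤s; _≤?_; _<?_; NonZero)
open import Data.Nat.Coprimality using (Coprime; coprime-divisor)
open import Data.Nat.DivMod using (m≡m%n+[m/n]*n; m%n<n)
open import Data.Nat.Divisibility
  using (_∣_; divides; _∣?_; _∣0; ∣-reflexive; ∣m∣n⇒∣m+n; ∣⇒≤; 0∣⇒≡0; *-monoʳ-∣; *-cancelˡ-∣)
open import Data.Nat.Induction using (<-wellFounded)
import Data.Nat.ListAction as List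
open import Data.Nat.Primality using (Prime; prime?; prime⇒irreducible; prime⇒nonZero)
open import Data.Nat.Properties hiding (_≟_)
open import Data.Nat.Tactic.RingSolver using (solve-∀)
open import Data.Product using (∃; ∃-syntax; _×_; _,_; proj₁; proj₂)
open import Data.Product.Relation.Binary.Lex.Strict using (×-Lex; ×-wellFounded)
open import Data.Sum using (inj₁; inj₂; [_,_]′)
open import Data.Vec using ([]; _∷_)
open import Function using (_∘_; case_of_)
open import Induction.WellFounded using (WellFounded; module All)
import Relation.Binary.Construct.On as On
open import Relation.Binary.PropositionalEquality
open import Relation.Nullary using (¬_; yes; no; contradiction)
open import Relation.Nullary.Decidable using (from-yes; decidable-stable)

import Algebra.Properties.CommutativeSemigroup +-commutativeSemigroup as ℕ+
import Algebra.Properties.CommutativeSemigroup *-commutativeSemigroup as ℕ*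
open CommutativeMonoidSum +-0-commutativeMonoid using (sum-syntax; sum-permute; sum-cong-≗)


-- Z5^n as an abelian group

⊕₅-assoc : ∀ a b c → (a ⊕₅ b) ⊕₅ c ≡ a ⊕₅ (b ⊕₅ c)
⊕₅-assoc = from-yes (all? λ a → all? λ b → all? λ c → (a ⊕₅ b) ⊕₅ c ≟ a ⊕₅ (b ⊕₅ c))

⊕₅-comm : ∀ a b → a ⊕₅ b ≡ b ⊕₅ a
⊕₅-comm = from-yes (all? λ a → all? λ b → a ⊕₅ b ≟ b ⊕₅ a)

⊕₅-identityʳ : ∀ a → a ⊕₅ zero ≡ a
⊕₅-identityʳ = from-yes (all? λ a → a ⊕₅ zero ≟ a)

⊕₅-inverseʳ : ∀ a → a ⊕₅ neg₅ a ≡ zero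
⊕₅-inverseʳ = from-yes (all? λ a → a ⊕₅ neg₅ a ≟ zero)

⊕-assoc : ∀ {n} (x y z : Z5^ n) → (x ⊕ y) ⊕ z ≡ x ⊕ (y ⊕ z)
⊕-assoc []      []      []      = refl
⊕-assoc (a ∷ x) (b ∷ y) (c ∷ z) = cong₂ _∷_ (⊕₅-assoc a b c) (⊕-assoc x y z)

⊕-comm : ∀ {n} (x y : Z5^ n) → x ⊕ y ≡ y ⊕ x
⊕-comm []      []      = refl
⊕-comm (a ∷ x) (b ∷ y) = cong₂ _∷_ (⊕₅-comm a b) (⊕-comm x y)

⊕-identityʳ : ∀ {n} (x : Z5^ n) → x ⊕ 𝟘 ≡ x
⊕-identityʳ []      = refl
⊕-identityʳ (a ∷ x) = cong₂ _∷_ (⊕₅-identityʳ a) (⊕-identityʳ x)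

⊕-identityˡ : ∀ {n} (x : Z5^ n) → 𝟘 ⊕ x ≡ x
⊕-identityˡ x = trans (⊕-comm 𝟘 x) (⊕-identityʳ x)

⊕-inverseʳ : ∀ {n} (x : Z5^ n) → x ⊕ (⊖ x) ≡ 𝟘
⊕-inverseʳ []      = refl
⊕-inverseʳ (a ∷ x) = cong₂ _∷_ (⊕₅-inverseʳ a) (⊕-inverseʳ x)

⊕-isAbelianGroup : ∀ n → IsAbelianGroup _≡_ (_⊕_ {n}) 𝟘 ⊖_
⊕-isAbelianGroup n = record
  { isGroup = record
    { isMonoid = record
      { isSemigroup = record
        { isMagma = record { isEquivalence = isEquivalence ; ∙-cong = cong₂ _⊕_ }
        ; assoc   = ⊕-assoc }
      ; identity = ⊕-identityˡ , ⊕-identityʳ }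
    ; inverse = (λ x → trans (⊕-comm (⊖ x) x) (⊕-inverseʳ x)) , ⊕-inverseʳ
    ; ⁻¹-cong = cong ⊖_ }
  ; comm = ⊕-comm }

Z5^-abelianGroup : ℕ → AbelianGroup _ _
Z5^-abelianGroup n = record { isAbelianGroup = ⊕-isAbelianGroup n }

open module Z5^-properties {n} = Algebra.Properties.AbelianGroup (Z5^-abelianGroup n)
  using (⁻¹-involutive; ⁻¹-∙-comm; //-rightDividesˡ; //-rightDividesʳ; \\-leftDividesˡ; \\-leftDividesʳ; ε⁻¹≈ε)
open module Z5^-mult {n} = Algebra.Properties.Monoid.Mult (AbelianGroup.monoid (Z5^-abelianGroup n))
  using (×-homo-+; ×-assocˡ) renaming (_×_ to infixr 30 _·_)
open module Z5^-commutativeSemigroup {n} =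
  Algebra.Properties.CommutativeSemigroup (AbelianGroup.commutativeSemigroup (Z5^-abelianGroup n))
  using (interchange; xy∙z≈xz∙y)

5·x≡𝟘 : ∀ {n} (x : Z5^ n) → 5 · x ≡ 𝟘
5·x≡𝟘 []      = refl
5·x≡𝟘 (a ∷ x) = cong₂ _∷_ (from-yes (all? λ a → a ⊕₅ (a ⊕₅ (a ⊕₅ (a ⊕₅ (a ⊕₅ zero)))) ≟ zero) a) (5·x≡𝟘 x)

⊖x≡4·x : ∀ {n} (x : Z5^ n) → ⊖ x ≡ 4 · x
⊖x≡4·x []      = refl
⊖x≡4·x (a ∷ x) = cong₂ _∷_ (from-yes (all? λ a → neg₅ a ≟ a ⊕₅ (a ⊕₅ (a ⊕₅ (a ⊕₅ zero)))) a) (⊖x≡4·x x)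

k·𝟘≡𝟘 : ∀ {n} k → k · 𝟘 {n} ≡ 𝟘
k·𝟘≡𝟘 zero    = refl
k·𝟘≡𝟘 (suc k) = trans (cong (𝟘 ⊕_) (k·𝟘≡𝟘 k)) (⊕-identityʳ 𝟘)

k·x≡[k%5]·x : ∀ {n} k (x : Z5^ n) → k · x ≡ (k % 5) · x
k·x≡[k%5]·x k x = begin
  k · x                                 ≡⟨ cong (_· x) (m≡m%n+[m/n]*n k 5) ⟩
  (k % 5 + k / 5 * 5) · x               ≡⟨ ×-homo-+ x (k % 5) (k / 5 * 5) ⟩
  (k % 5) · x ⊕ (k / 5 * 5) · x         ≡⟨ cong ((k % 5) · x ⊕_) (sym (×-assocˡ x (k / 5) 5)) ⟩
  (k % 5) · x ⊕ (k / 5) · (5 · x)       ≡⟨ cong (λ y → (k % 5) · x ⊕ (k / 5) · y) (5·x≡𝟘 x) ⟩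
  (k % 5) · x ⊕ (k / 5) · 𝟘             ≡⟨ cong ((k % 5) · x ⊕_) (k·𝟘≡𝟘 (k / 5)) ⟩
  (k % 5) · x ⊕ 𝟘                       ≡⟨ ⊕-identityʳ _ ⟩
  (k % 5) · x                           ∎
  where open ≡-Reasoning


module _ {A : Set} where

  count : (A → Bool) → List A → ℕ
  count p xs = length (filter (λ x → T? (p x)) xs)

  count-cong : ∀ {p q : A → Bool} → (∀ x → p x ≡ q x) → ∀ xs → count p xs ≡ count q xs
  count-cong p≗q []       = refl
  count-cong {p} {q} p≗q (x ∷ xs) with p x | q x | p≗q x
  ... | true  | true  | _ = cong suc (count-cong p≗q xs)
  ... | false | false | _ = count-cong p≗q xs

  count-mono : ∀ {p q : A → Bool} → (∀ x → p x ≡ true → q x ≡ true) → ∀ xs → count p xs ≤ count q xs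
  count-mono p⇒q []       = z≤n
  count-mono {p} {q} p⇒q (x ∷ xs) with p x | q x | p⇒q x
  ... | true  | true  | _ = s≤s (count-mono p⇒q xs)
  ... | true  | false | h with () ← h refl
  ... | false | true  | _ = m≤n⇒m≤1+n (count-mono p⇒q xs)
  ... | false | false | _ = count-mono p⇒q xs

  count-none : ∀ {p : A → Bool} → (∀ x → p x ≡ false) → ∀ xs → count p xs ≡ 0
  count-none p≡false []       = refl
  count-none {p} p≡false (x ∷ xs) rewrite p≡false x = count-none p≡false xs

  count-∨+count-∧ : ∀ (p q : A → Bool) xs →
    count (λ x → p x ∨ q x) xs + count (λ x → p x ∧ q x) xs ≡ count p xs + count q xs
  count-∨+count-∧ p q []       = refl
  count-∨+count-∧ p q (x ∷ xs) with p x | q x | count-∨+count-∧ p q xs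
  ... | true  | true  | ih = cong suc (trans (+-suc _ _) (trans (cong suc ih) (sym (+-suc _ _))))
  ... | true  | false | ih = cong suc ih
  ... | false | true  | ih = trans (cong suc ih) (sym (+-suc _ _))
  ... | false | false | ih = ih

  count-∧+count-∧not : ∀ (p q : A → Bool) xs →
    count (λ x → p x ∧ q x) xs + count (λ x → p x ∧ not (q x)) xs ≡ count p xs
  count-∧+count-∧not p q []       = refl
  count-∧+count-∧not p q (x ∷ xs) with p x | q x | count-∧+count-∧not p q xs
  ... | true  | true  | ih = cong suc ih
  ... | true  | false | ih = trans (+-suc _ _) (cong suc ih)
  ... | false | _     | ih = ih

  count-pos : ∀ (p : A → Bool) {x xs} → x ∈ xs → p x ≡ true → 0 < count p xs
  count-pos p {xs = y ∷ ys} (here refl) px rewrite px = s≤s z≤n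
  count-pos p {xs = y ∷ ys} (there x∈ys) px with p y
  ... | true  = s≤s z≤n
  ... | false = count-pos p x∈ys px

  count-witness : ∀ (p : A → Bool) xs → 0 < count p xs → ∃ λ x → p x ≡ true
  count-witness p (x ∷ xs) pos with p x in px
  ... | true  = x , px
  ... | false = count-witness p xs pos

  count-concat : ∀ (p : A → Bool) xss → count p (concat xss) ≡ List.sum (map (count p) xss)
  count-concat p []         = refl
  count-concat p (xs ∷ xss) = trans (count-++ xs) (cong (count p xs +_) (count-concat p xss))
    where
    count-++ : ∀ xs → count p (xs ++ concat xss) ≡ count p xs + count p (concat xss)
    count-++ []       = refl
    count-++ (x ∷ xs) with p x
    ... | true  = cong suc (count-++ xs)
    ... | false = count-++ xs

count-map : ∀ {A B : Set} (p : B → Bool) (f : A → B) xs → count p (map f xs) ≡ count (p ∘ f) xs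
count-map p f []       = refl
count-map p f (x ∷ xs) with p (f x)
... | true  = cong suc (count-map p f xs)
... | false = count-map p f xs

elems-complete : ∀ {n} (x : Z5^ n) → x ∈ elems n
elems-complete []      = here refl
elems-complete (a ∷ x) =
  ∈-concat⁺′ (∈-map⁺ (a ∷_) (elems-complete x)) (∈-map⁺ (λ b → map (b ∷_) (elems _)) (∈-allFin a))

card-pos : ∀ {n} (S : Subset n) {x} → x ∈ₛ S → 0 < card S
card-pos S {x} = count-pos S (elems-complete x)

card-witness : ∀ {n} (S : Subset n) → 0 < card S → ∃ λ x → x ∈ₛ S
card-witness {n} S = count-witness S (elems n)

card-cons : ∀ {n} (P : Subset (suc n)) → card P ≡ ∑[ a < 5 ] card (λ x → P (a ∷ x))
card-cons {n} P = trans (count-concat P (map (λ a → map (a ∷_) (elems n)) (allFin 5)))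
                        (sum-cong-≗ λ a → count-map P (a ∷_) (elems n))

card-cons-permute : ∀ {n} (π : Permutation′ 5) (f : Z5^ n → Z5^ n) (h : Z5^ (suc n) → Z5^ (suc n)) →
  (∀ a x → h (a ∷ x) ≡ (π ⟨$⟩ʳ a) ∷ f x) → (∀ Q → card (Q ∘ f) ≡ card Q) → ∀ P → card (P ∘ h) ≡ card P
card-cons-permute {n} π f h h-cons f-inv P = begin
  card (P ∘ h)                                  ≡⟨ card-cons (P ∘ h) ⟩
  ∑[ a < 5 ] card (λ x → P (h (a ∷ x)))
    ≡⟨ sum-cong-≗ (λ a → count-cong (λ x → cong P (h-cons a x)) (elems n)) ⟩
  ∑[ a < 5 ] card (λ x → P ((π ⟨$⟩ʳ a) ∷ f x))   ≡⟨ sum-cong-≗ (λ a → f-inv (λ x → P ((π ⟨$⟩ʳ a) ∷ x))) ⟩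
  ∑[ a < 5 ] card (λ x → P ((π ⟨$⟩ʳ a) ∷ x))     ≡⟨ sum-permute (λ a → card (λ x → P (a ∷ x))) π ⟨
  ∑[ a < 5 ] card (λ x → P (a ∷ x))               ≡⟨ card-cons P ⟨
  card P                                          ∎
  where open ≡-Reasoning

translation₅ : Fin 5 → Permutation′ 5
translation₅ g = permutation (_⊕₅ g) (_⊕₅ neg₅ g)
  (from-yes (all? λ g → all? λ a → (a ⊕₅ neg₅ g) ⊕₅ g ≟ a) g)
  (from-yes (all? λ g → all? λ a → (a ⊕₅ g) ⊕₅ neg₅ g ≟ a) g)

negation₅ : Permutation′ 5
negation₅ = permutation neg₅ neg₅ (from-yes (all? λ a → neg₅ (neg₅ a) ≟ a)) (from-yes (all? λ a → neg₅ (neg₅ a) ≟ a))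

card-translate : ∀ {n} (P : Subset n) (g : Z5^ n) → card (λ x → P (x ⊕ g)) ≡ card P
card-translate P []      = count-cong {p = λ x → P (x ⊕ [])} {q = P} (λ { [] → refl }) (elems 0)
card-translate P (a ∷ g) =
  card-cons-permute (translation₅ a) (_⊕ g) (_⊕ (a ∷ g)) (λ _ _ → refl) (λ Q → card-translate Q g) P

card-negate : ∀ {n} (P : Subset n) → card (λ x → P (⊖ x)) ≡ card P
card-negate {zero}  P = count-cong {p = λ x → P (⊖ x)} {q = P} (λ { [] → refl }) (elems 0)
card-negate {suc n} P = card-cons-permute negation₅ ⊖_ ⊖_ (λ _ _ → refl) card-negate P

card-all : ∀ n → card {n} (λ _ → true) ≡ 5 ^ n
card-all zero    = refl
card-all (suc n) = trans (card-cons {n} (λ _ → true)) (cong (λ c → c + (c + (c + (c + (c + 0))))) (card-all n))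


∧-intro : ∀ {a b} → a ≡ true → b ≡ true → a ∧ b ≡ true
∧-intro refl refl = refl

≡true-ext : ∀ {a b} → (a ≡ true → b ≡ true) → (b ≡ true → a ≡ true) → a ≡ b
≡true-ext {false} {false} _   _   = refl
≡true-ext {false} {true}  _   b⇒a = b⇒a refl
≡true-ext {true}          a⇒b _   = sym (a⇒b refl)

not-intro : ∀ {b} → (b ≡ true → ⊥) → not b ≡ true
not-intro {false} _   = refl
not-intro {true}  b≢true = contradiction refl b≢true

not-elim : ∀ {b} → not b ≡ true → b ≡ true → ⊥
not-elim {false} _ ()

any-intro : ∀ {A : Set} (p : A → Bool) {x xs} → x ∈ xs → p x ≡ true → any p xs ≡ true
any-intro p (here refl) px rewrite px = refl
any-intro p {xs = y ∷ ys} (there x∈ys) px with p y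
... | true  = refl
... | false = any-intro p x∈ys px

any-witness : ∀ {A : Set} (p : A → Bool) xs → any p xs ≡ true → ∃ λ x → x ∈ xs × p x ≡ true
any-witness p (x ∷ xs) any≡true with p x in px
... | true  = x , here refl , px
... | false with y , y∈xs , py ← any-witness p xs any≡true = y , there y∈xs , py


-- Sumsets

module _ {n : ℕ} where

  infix 4 _⊆_
  infixl 6 _+ₛ_

  _⊆_ : Subset n → Subset n → Set
  S ⊆ T = ∀ x → x ∈ₛ S → x ∈ₛ T

  card-mono : ∀ {S T : Subset n} → S ⊆ T → card S ≤ card T
  card-mono S⊆T = count-mono S⊆T (elems n)

  card-∖ : ∀ {S T : Subset n} → S ⊆ T → card (λ z → T z ∧ not (S z)) + card S ≡ card T
  card-∖ {S} {T} S⊆T = trans (+-comm _ (card S))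
    (trans (cong (_+ card (λ z → T z ∧ not (S z))) (sym (count-cong T∩S≗S (elems n))))
           (count-∧+count-∧not T S (elems n)))
    where
    T∩S≗S : ∀ z → T z ∧ S z ≡ S z
    T∩S≗S z with S z in z∈?S
    ... | false = ∧-zeroʳ (T z)
    ... | true  = cong (_∧ true) (S⊆T z z∈?S)

  card-disjoint-∪ : ∀ {S T U : Subset n} → S ⊆ U → T ⊆ U → (∀ z → z ∈ₛ S → z ∈ₛ T → ⊥) → card S + card T ≤ card U
  card-disjoint-∪ {S} {T} {U} S⊆U T⊆U disjoint = begin
    card S + card T                                        ≡⟨ count-∨+count-∧ S T (elems n) ⟨
    card (λ z → S z ∨ T z) + card (λ z → S z ∧ T z)
      ≡⟨ cong (card (λ z → S z ∨ T z) +_) (count-none S∩T-empty (elems n)) ⟩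
    card (λ z → S z ∨ T z) + 0                             ≡⟨ +-identityʳ _ ⟩
    card (λ z → S z ∨ T z)                                 ≤⟨ card-mono S∪T⊆U ⟩
    card U                                                 ∎
    where
    open ≤-Reasoning
    S∩T-empty : ∀ z → S z ∧ T z ≡ false
    S∩T-empty z with S z in z∈?S | T z in z∈?T
    ... | false | _     = refl
    ... | true  | false = refl
    ... | true  | true  = contradiction z∈?T (disjoint z z∈?S)
    S∪T⊆U : (λ z → S z ∨ T z) ⊆ U
    S∪T⊆U z z∈S∪T with S z in z∈?S
    ... | true  = S⊆U z z∈?S
    ... | false = T⊆U z z∈S∪T

  card-≤-sum-cover : ∀ {A : Set} (P : Subset n) (Q : A → Subset n) ks →
    (∀ g → g ∈ₛ P → any (λ k → Q k g) ks ≡ true) → card P ≤ List.sum (map (λ k → card (Q k)) ks)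
  card-≤-sum-cover P Q [] covered = ≤-reflexive (count-none P-empty (elems n))
    where
    P-empty : ∀ g → P g ≡ false
    P-empty g with P g in g∈?P
    ... | true  = contradiction (covered g g∈?P) λ ()
    ... | false = refl
  card-≤-sum-cover P Q (k ∷ ks) covered = begin
    card P                                                 ≡⟨ count-∧+count-∧not P (Q k) (elems n) ⟨
    card (λ g → P g ∧ Q k g) + card P∖Qk                   ≤⟨ +-mono-≤ (card-mono λ g → ∧-conicalʳ _ _)
                                                                      (card-≤-sum-cover P∖Qk Q ks P∖Qk-covered) ⟩
    card (Q k) + List.sum (map (λ k → card (Q k)) ks)      ∎
    where
    open ≤-Reasoning
    P∖Qk : Subset n
    P∖Qk g = P g ∧ not (Q k g)
    P∖Qk-covered : ∀ g → g ∈ₛ P∖Qk → any (λ k → Q k g) ks ≡ true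
    P∖Qk-covered g g∈P∖Qk with Q k g in g∈?Qk | covered g (∧-conicalˡ _ _ g∈P∖Qk)
    ... | false | covered-by-ks = covered-by-ks
    ... | true  | _ = contradiction (∧-conicalʳ _ _ g∈P∖Qk) (subst (λ b → not b ≡ true → ⊥) (sym g∈?Qk) λ ())

  _+ₛ_ : Subset n → Subset n → Subset n
  (S +ₛ T) z = any (λ s → S s ∧ T ((⊖ s) ⊕ z)) (elems n)

  +ₛ-intro : ∀ {S T : Subset n} {s t} → s ∈ₛ S → t ∈ₛ T → (s ⊕ t) ∈ₛ (S +ₛ T)
  +ₛ-intro {S} {T} {s} {t} s∈S t∈T =
    any-intro _ (elems-complete s) (∧-intro s∈S (subst (λ x → x ∈ₛ T) (sym (\\-leftDividesʳ s t)) t∈T))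

  +ₛ-elim : ∀ {S T : Subset n} {z} → z ∈ₛ (S +ₛ T) → ∃[ s ] ∃[ t ] s ∈ₛ S × t ∈ₛ T × z ≡ s ⊕ t
  +ₛ-elim {S} {T} {z} z∈S+T with any-witness _ (elems n) z∈S+T
  ... | s , _ , s∈S∧ = s , (⊖ s) ⊕ z , ∧-conicalˡ _ _ s∈S∧ , ∧-conicalʳ _ _ s∈S∧ , sym (\\-leftDividesˡ s z)

  +ₛ-monoˡ : ∀ {S T : Subset n} (W : Subset n) → S ⊆ T → (S +ₛ W) ⊆ (T +ₛ W)
  +ₛ-monoˡ {S} {T} W S⊆T z z∈ with +ₛ-elim {S = S} {W} z∈
  ... | s , w , s∈S , w∈W , refl = +ₛ-intro {S = T} {W} (S⊆T s s∈S) w∈W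

  card-≤-+ₛ : ∀ (S : Subset n) {T w} → w ∈ₛ T → card S ≤ card (S +ₛ T)
  card-≤-+ₛ S {T} {w} w∈T = begin
    card S                      ≡⟨ card-translate S (⊖ w) ⟨
    card (λ z → S (z ⊕ (⊖ w)))  ≤⟨ card-mono S-w+w⊆S+T ⟩
    card (S +ₛ T)               ∎
    where
    open ≤-Reasoning
    S-w+w⊆S+T : (λ z → S (z ⊕ (⊖ w))) ⊆ (S +ₛ T)
    S-w+w⊆S+T z z-w∈S = subst (_∈ₛ (S +ₛ T)) (//-rightDividesˡ w z) (+ₛ-intro {S = S} {T} z-w∈S w∈T)

  card-≤-+ₛʳ : ∀ {S} (T : Subset n) → 𝟘 ∈ₛ S → card T ≤ card (S +ₛ T)
  card-≤-+ₛʳ {S} T 𝟘∈S = card-mono λ z z∈T → subst (_∈ₛ (S +ₛ T)) (⊕-identityˡ z) (+ₛ-intro {S = S} {T} 𝟘∈S z∈T)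

  +ₛ-translate : ∀ (S T : Subset n) g z → ((λ y → S (y ⊕ g)) +ₛ T) z ≡ (S +ₛ T) (z ⊕ g)
  +ₛ-translate S T g z = ≡true-ext to from
    where
    to : z ∈ₛ ((λ y → S (y ⊕ g)) +ₛ T) → (z ⊕ g) ∈ₛ (S +ₛ T)
    to z∈ with +ₛ-elim {S = λ y → S (y ⊕ g)} {T} z∈
    ... | s , t , s⊕g∈S , t∈T , z≡s⊕t =
      subst (_∈ₛ (S +ₛ T)) (trans (xy∙z≈xz∙y s g t) (cong (_⊕ g) (sym z≡s⊕t))) (+ₛ-intro {S = S} {T} s⊕g∈S t∈T)
    from : (z ⊕ g) ∈ₛ (S +ₛ T) → z ∈ₛ ((λ y → S (y ⊕ g)) +ₛ T)
    from z⊕g∈ with +ₛ-elim {S = S} {T} z⊕g∈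
    ... | s , t , s∈S , t∈T , z⊕g≡s⊕t =
      subst (_∈ₛ ((λ y → S (y ⊕ g)) +ₛ T)) z≡ (+ₛ-intro {S = λ y → S (y ⊕ g)} {T} s-g∈ t∈T)
      where
      s-g∈ : (s ⊕ (⊖ g)) ∈ₛ (λ y → S (y ⊕ g))
      s-g∈ = subst (_∈ₛ S) (sym (//-rightDividesˡ g s)) s∈S
      z≡ : (s ⊕ (⊖ g)) ⊕ t ≡ z
      z≡ = begin
        (s ⊕ (⊖ g)) ⊕ t  ≡⟨ xy∙z≈xz∙y s (⊖ g) t ⟩
        (s ⊕ t) ⊕ (⊖ g)  ≡⟨ cong (_⊕ (⊖ g)) z⊕g≡s⊕t ⟨
        (z ⊕ g) ⊕ (⊖ g)  ≡⟨ //-rightDividesʳ g z ⟩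
        z                ∎
        where open ≡-Reasoning

  card-+ₛ-translate : ∀ (S T : Subset n) g → card ((λ y → S (y ⊕ g)) +ₛ T) ≡ card (S +ₛ T)
  card-+ₛ-translate S T g = trans (count-cong (+ₛ-translate S T g) (elems n)) (card-translate (S +ₛ T) g)

  card-+ₛ-submodular : ∀ (S T W : Subset n) →
    card ((λ z → S z ∨ T z) +ₛ W) + card ((λ z → S z ∧ T z) +ₛ W) ≤ card (S +ₛ W) + card (T +ₛ W)
  card-+ₛ-submodular S T W = begin
    card ((λ z → S z ∨ T z) +ₛ W) + card ((λ z → S z ∧ T z) +ₛ W)
      ≤⟨ +-mono-≤ (card-mono ∪+W⊆) (card-mono ∩+W⊆) ⟩
    card (λ z → (S +ₛ W) z ∨ (T +ₛ W) z) + card (λ z → (S +ₛ W) z ∧ (T +ₛ W) z)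
      ≡⟨ count-∨+count-∧ (S +ₛ W) (T +ₛ W) (elems n) ⟩
    card (S +ₛ W) + card (T +ₛ W) ∎
    where
    open ≤-Reasoning
    ∪+W⊆ : ((λ z → S z ∨ T z) +ₛ W) ⊆ (λ z → (S +ₛ W) z ∨ (T +ₛ W) z)
    ∪+W⊆ z z∈ with +ₛ-elim {S = λ z → S z ∨ T z} {W} z∈
    ... | s , w , s∈S∪T , w∈W , refl with S s in s∈?S
    ...   | true  = cong (_∨ _) (+ₛ-intro {S = S} {W} s∈?S w∈W)
    ...   | false = trans (cong (_ ∨_) (+ₛ-intro {S = T} {W} s∈S∪T w∈W)) (∨-zeroʳ _)
    ∩+W⊆ : ((λ z → S z ∧ T z) +ₛ W) ⊆ (λ z → (S +ₛ W) z ∧ (T +ₛ W) z)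
    ∩+W⊆ z z∈ with +ₛ-elim {S = λ z → S z ∧ T z} {W} z∈
    ... | s , w , s∈S∩T , w∈W , refl =
      ∧-intro (+ₛ-intro {S = S} {W} (∧-conicalˡ _ _ s∈S∩T) w∈W) (+ₛ-intro {S = T} {W} (∧-conicalʳ _ _ s∈S∩T) w∈W)


-- Subgroups

module Subgroup {n} {K : Subset n} (K-subgroup : IsSubgroup K) where

  𝟘∈K : 𝟘 ∈ₛ K
  𝟘∈K = proj₁ K-subgroup

  ⊕-closed : ∀ x y → x ∈ₛ K → y ∈ₛ K → (x ⊕ y) ∈ₛ K
  ⊕-closed = proj₁ (proj₂ K-subgroup)

  ⊖-closed : ∀ x → x ∈ₛ K → (⊖ x) ∈ₛ K
  ⊖-closed = proj₂ (proj₂ K-subgroup)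

  ⊖-closed⁻¹ : ∀ x → (⊖ x) ∈ₛ K → x ∈ₛ K
  ⊖-closed⁻¹ x ⊖x∈K = subst (_∈ₛ K) (⁻¹-involutive x) (⊖-closed (⊖ x) ⊖x∈K)

  ⊕-cancel : ∀ {z k} → k ∈ₛ K → (z ⊕ k) ∈ₛ K → z ∈ₛ K
  ⊕-cancel {z} {k} k∈K z⊕k∈K = subst (_∈ₛ K) (//-rightDividesʳ k z) (⊕-closed _ _ z⊕k∈K (⊖-closed k k∈K))

  ∈-⊕-invariant : ∀ {z k} → k ∈ₛ K → K (z ⊕ k) ≡ K z
  ∈-⊕-invariant {z} {k} k∈K = ≡true-ext (⊕-cancel k∈K) λ z∈K → ⊕-closed z k z∈K k∈K

  Periodic : Subset n → Set
  Periodic S = ∀ x k → x ∈ₛ S → k ∈ₛ K → (x ⊕ k) ∈ₛ S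

  -- Lagrange: a coset s + K ⊆ S has |K| elements; remove it and recurse (with fuel |S|).
  card-∣-periodic : ∀ {S} → Periodic S → card K ∣ card S
  card-∣-periodic {S} = go (card S) ≤-refl
    where
    go : ∀ fuel {S} → card S ≤ fuel → Periodic S → card K ∣ card S
    go fuel {S} |S|≤ S-periodic with 0 <? card S
    ... | no  |S|≯0 = subst (card K ∣_) (sym (n≤0⇒n≡0 (≮⇒≥ |S|≯0))) (card K ∣0)
    go zero       {S} |S|≤ S-periodic | yes |S|>0 = contradiction (≤-trans |S|>0 |S|≤) λ ()
    go (suc fuel) {S} |S|≤ S-periodic | yes |S|>0 =
      subst (card K ∣_) split (∣m∣n⇒∣m+n (∣-reflexive (sym |S∩s+K|≡|K|)) (go fuel |S∖s+K|≤ S∖s+K-periodic))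
      where
      s : Z5^ n
      s = proj₁ (card-witness S |S|>0)
      s∈S : s ∈ₛ S
      s∈S = proj₂ (card-witness S |S|>0)
      s+K : Subset n
      s+K z = K (z ⊕ (⊖ s))
      S∖s+K : Subset n
      S∖s+K z = S z ∧ not (s+K z)
      split : card (λ z → S z ∧ s+K z) + card S∖s+K ≡ card S
      split = count-∧+count-∧not S s+K (elems n)
      |S∩s+K|≡|K| : card (λ z → S z ∧ s+K z) ≡ card K
      |S∩s+K|≡|K| = trans (count-cong S∩s+K≗s+K (elems n)) (card-translate K (⊖ s))
        where
        S∩s+K≗s+K : ∀ z → S z ∧ s+K z ≡ s+K z
        S∩s+K≗s+K z with s+K z in z∈s+K
        ... | false = ∧-zeroʳ (S z)
        ... | true  = cong (_∧ true) z∈S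
          where
          z∈S : z ∈ₛ S
          z∈S = subst (_∈ₛ S) (trans (⊕-comm s _) (//-rightDividesˡ s z)) (S-periodic s _ s∈S z∈s+K)
      |S∖s+K|≤ : card S∖s+K ≤ fuel
      |S∖s+K|≤ = ≤-pred (≤-trans |S∖s+K|<|S| |S|≤)
        where
        |S∖s+K|<|S| : card S∖s+K < card S
        |S∖s+K|<|S| = ≤-trans (+-monoˡ-≤ (card S∖s+K) (card-pos K 𝟘∈K))
          (≤-reflexive (trans (cong (_+ card S∖s+K) (sym |S∩s+K|≡|K|)) split))
      S∖s+K-periodic : Periodic S∖s+K
      S∖s+K-periodic z k z∈S∖s+K k∈K with s+K (z ⊕ k) in z⊕k∈?s+K
      ... | false = ∧-intro (S-periodic z k (∧-conicalˡ _ _ z∈S∖s+K) k∈K) refl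
      ... | true  = contradiction (subst (λ b → not b ≡ true) z∈s+K (∧-conicalʳ _ _ z∈S∖s+K)) λ ()
        where
        z∈s+K : s+K z ≡ true
        z∈s+K = ⊕-cancel k∈K (subst (_∈ₛ K) (xy∙z≈xz∙y z k (⊖ s)) z⊕k∈?s+K)

  +ₛ-periodic : ∀ (W : Subset n) → Periodic (K +ₛ W)
  +ₛ-periodic W z k z∈K+W k∈K with +ₛ-elim {S = K} {W} z∈K+W
  ... | c , w , c∈K , w∈W , refl =
    subst (_∈ₛ (K +ₛ W)) (xy∙z≈xz∙y c k w) (+ₛ-intro {S = K} {W} (⊕-closed c k c∈K k∈K) w∈W)

·-closed : ∀ {n} {X : Subset n} → 𝟘 ∈ₛ X → (∀ x y → x ∈ₛ X → y ∈ₛ X → (x ⊕ y) ∈ₛ X) → ∀ k {x} → x ∈ₛ X → (k · x) ∈ₛ X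
·-closed 𝟘∈X +-closed zero    x∈X = 𝟘∈X
·-closed 𝟘∈X +-closed (suc k) x∈X = +-closed _ _ x∈X (·-closed 𝟘∈X +-closed k x∈X)

-- Since ⊖ x = 4 · x, additive closure suffices.
+-closed⇒subgroup : ∀ {n} {X : Subset n} → 𝟘 ∈ₛ X → (∀ x y → x ∈ₛ X → y ∈ₛ X → (x ⊕ y) ∈ₛ X) → IsSubgroup X
+-closed⇒subgroup {X = X} 𝟘∈X +-closed =
  𝟘∈X , +-closed , λ x x∈X → subst (_∈ₛ X) (sym (⊖x≡4·x x)) (·-closed 𝟘∈X +-closed 4 x∈X)


-- Isoperimetric growth in a subgroup of order 5^m

*-∣-prime-power : ∀ {p} → Prime p → ∀ m {d} → d ∣ p ^ m → d < p ^ m → p * d ∣ p ^ m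
*-∣-prime-power pr zero {zero}  0∣1 _ with () ← 0∣⇒≡0 0∣1
*-∣-prime-power pr zero {suc d} _ (s≤s ())
*-∣-prime-power {p} pr (suc m) {d} d∣p^[1+m] d<p^[1+m] with p ∣? d
... | yes (divides e refl) = subst (λ x → p * x ∣ p ^ suc m) (*-comm p e)
      (*-monoʳ-∣ p (*-∣-prime-power pr m (*-cancelˡ-∣ p e*p∣p^[1+m]) (*-cancelˡ-< p _ _ e*p<p^[1+m])))
  where
  instance
    p≢0 : NonZero p
    p≢0 = prime⇒nonZero pr
  e*p∣p^[1+m] : p * e ∣ p * p ^ m
  e*p∣p^[1+m] = subst (_∣ p ^ suc m) (*-comm e p) d∣p^[1+m]
  e*p<p^[1+m] : p * e < p * p ^ m
  e*p<p^[1+m] = subst (_< p ^ suc m) (*-comm e p) d<p^[1+m]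
... | no p∤d = *-monoʳ-∣ p (coprime-divisor d⊥p d∣p^[1+m])
  where
  d⊥p : Coprime d p
  d⊥p (c∣d , c∣p) with prime⇒irreducible pr c∣p
  ... | inj₁ c≡1    = c≡1
  ... | inj₂ refl   = contradiction c∣d p∤d

prime[5] : Prime 5
prime[5] = from-yes (prime? 5)

multiples-gap : ∀ {s b M} → s ∣ b → 5 * s ∣ M → 2 * M < 5 * b → 5 * s + 2 * M ≤ 5 * b
multiples-gap {s} (divides q refl) (divides e refl) 2M<5b = begin
  5 * s + 2 * (e * (5 * s))  ≡⟨ cong (5 * s +_) (*-assoc 2 e (5 * s)) ⟨
  suc (2 * e) * (5 * s)      ≤⟨ *-monoˡ-≤ (5 * s) 2e<q ⟩
  q * (5 * s)                ≡⟨ q*[5*s]≡5*[q*s] ⟩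
  5 * (q * s)                ∎
  where
  open ≤-Reasoning
  q*[5*s]≡5*[q*s] : q * (5 * s) ≡ 5 * (q * s)
  q*[5*s]≡5*[q*s] = trans (sym (*-assoc q 5 s)) (trans (cong (_* s) (*-comm q 5)) (*-assoc 5 q s))
  2e<q : 2 * e < q
  2e<q = *-cancelʳ-< (5 * s) (2 * e) q (subst₂ _<_ (sym (*-assoc 2 e (5 * s))) (sym q*[5*s]≡5*[q*s]) 2M<5b)

∸-+-rearrange : ∀ {x y z} → y ≤ x → x + z ≡ x ∸ y + (y + z)
∸-+-rearrange {x} {y} {z} y≤x = trans (cong (_+ z) (sym (m∸n+n≡m y≤x))) (+-assoc (x ∸ y) y z)

∸-cancel-< : ∀ {a b c d} → b ≤ a → d ≤ c → a + d < c + b → a ∸ b < c ∸ d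
∸-cancel-< {a} {b} {c} {d} b≤a d≤c a+d<c+b = +-cancelʳ-< (b + d) (a ∸ b) (c ∸ d)
  (subst₂ _<_ (∸-+-rearrange b≤a) (trans (∸-+-rearrange d≤c) (cong (c ∸ d +_) (+-comm d b))) a+d<c+b)

∸-cancel-≤ : ∀ {a b c d} → b ≤ a → d ≤ c → a + d ≤ c + b → a ∸ b ≤ c ∸ d
∸-cancel-≤ {a} {b} {c} {d} b≤a d≤c a+d≤c+b = +-cancelʳ-≤ (b + d) (a ∸ b) (c ∸ d)
  (subst₂ _≤_ (∸-+-rearrange b≤a) (trans (∸-+-rearrange d≤c) (cong (c ∸ d +_) (+-comm d b))) a+d≤c+b)

expansion-comparison : ∀ {M bC sC bD sD} → 5 * sD + 2 * M ≤ 5 * bD → 5 * bC < 5 * sC + 2 * M → bC + sD < bD + sC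
expansion-comparison {M} {bC} {sC} {bD} {sD} D-expands C-shrinks = *-cancelˡ-< 5 _ _ (begin-strict
  5 * (bC + sD)          ≡⟨ *-distribˡ-+ 5 bC sD ⟩
  5 * bC + 5 * sD        <⟨ +-monoˡ-< (5 * sD) C-shrinks ⟩
  5 * sC + 2 * M + 5 * sD  ≡⟨ ℕ+.xy∙z≈xz∙y (5 * sC) (2 * M) (5 * sD) ⟩
  5 * sC + 5 * sD + 2 * M  ≡⟨ +-assoc (5 * sC) (5 * sD) (2 * M) ⟩
  5 * sC + (5 * sD + 2 * M)  ≤⟨ +-monoʳ-≤ (5 * sC) D-expands ⟩
  5 * sC + 5 * bD        ≡⟨ *-distribˡ-+ 5 sC bD ⟨
  5 * (sC + bD)          ≡⟨ cong (5 *_) (+-comm sC bD) ⟩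
  5 * (bD + sC)          ∎)
  where open ≤-Reasoning

-- (b - s, s) is lexicographically minimal, stated without truncated subtraction.
lex-minimal : ∀ {bC sC bD sD} → sC ≤ bC → sD ≤ bD →
  (×-Lex _≡_ _<_ _<_ (bD ∸ sD , sD) (bC ∸ sC , sC) → bC + sD < bD + sC) →
  (bC + sD ≤ bD + sC) × (bD + sC ≤ bC + sD → sC ≤ sD)
lex-minimal {bC} {sC} {bD} {sD} sC≤bC sD≤bD smaller⇒< = C-bound , C-minimal
  where
  C-bound : bC + sD ≤ bD + sC
  C-bound = decidable-stable (bC + sD ≤? bD + sC) λ ¬bound →
    ¬bound (<⇒≤ (smaller⇒< (inj₁ (∸-cancel-< sD≤bD sC≤bC (≰⇒> ¬bound)))))
  C-minimal : bD + sC ≤ bC + sD → sC ≤ sD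
  C-minimal D-bound = decidable-stable (sC ≤? sD) λ sC≰sD → <⇒≱ (smaller⇒< (smaller sC≰sD)) D-bound
    where
    smaller : sC ≰ sD → ×-Lex _≡_ _<_ _<_ (bD ∸ sD , sD) (bC ∸ sC , sC)
    smaller sC≰sD with m≤n⇒m<n∨m≡n (∸-cancel-≤ sD≤bD sC≤bC D-bound)
    ... | inj₁ δD<δC = inj₁ δD<δC
    ... | inj₂ δD≡δC = inj₂ (δD≡δC , ≰⇒> sC≰sD)

submodular-step : ∀ {b s sU sI bU bI} → sU + sI ≡ s + s → bU + bI ≤ b + b → b + sU ≤ bU + s → bI + s ≤ b + sI
submodular-step {b} {s} {sU} {sI} {bU} {bI} sU+sI≡ bU+bI≤ b+sU≤ = +-cancelˡ-≤ (b + sU) _ _ (begin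
  (b + sU) + (bI + s)   ≤⟨ +-monoˡ-≤ (bI + s) b+sU≤ ⟩
  (bU + s) + (bI + s)   ≡⟨ ℕ+.interchange bU s bI s ⟩
  (bU + bI) + (s + s)   ≤⟨ +-monoˡ-≤ (s + s) bU+bI≤ ⟩
  (b + b) + (s + s)     ≡⟨ cong ((b + b) +_) (sym sU+sI≡) ⟩
  (b + b) + (sU + sI)   ≡⟨ ℕ+.interchange b b sU sI ⟩
  (b + sU) + (b + sI)   ∎)
  where open ≤-Reasoning

submodular-absurd : ∀ {M b s sI bU bI} → M ≤ bU → bU + bI ≤ b + b → b + sI ≤ bI + s → s + b ≤ M → 0 < sI → ⊥
submodular-absurd {M} {b} {s} {sI} {bU} {bI} M≤bU bU+bI≤ b+sI≤ s+b≤M 0<sI =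
  contradiction (≤-trans 0<sI (+-cancelʳ-≤ M sI 0 (+-cancelˡ-≤ b _ _ b+sI+M≤b+M))) λ ()
  where
  open ≤-Reasoning
  b+sI+M≤b+M : b + (sI + M) ≤ b + M
  b+sI+M≤b+M = begin
    b + (sI + M)     ≡⟨ +-assoc b sI M ⟨
    (b + sI) + M     ≤⟨ +-mono-≤ b+sI≤ M≤bU ⟩
    (bI + s) + bU    ≡⟨ ℕ+.xy∙z≈zx∙y bI s bU ⟩
    (bU + bI) + s    ≤⟨ +-monoˡ-≤ s bU+bI≤ ⟩
    (b + b) + s      ≡⟨ +-assoc b b s ⟩
    b + (b + s)      ≤⟨ +-monoʳ-≤ b (≤-trans (≤-reflexive (+-comm b s)) s+b≤M) ⟩
    b + M            ∎


module Isoperimetry {n} {H W : Subset n} (H-subgroup : IsSubgroup H) (W⊆H : W ⊆ H) where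

  open Subgroup H-subgroup using (⊕-closed; ⊖-closed⁻¹; ⊕-cancel)

  +W⊆H : ∀ {C} → C ⊆ H → (C +ₛ W) ⊆ H
  +W⊆H {C} C⊆H z z∈ with +ₛ-elim {S = C} {W} z∈
  ... | c , w , c∈C , w∈W , refl = ⊕-closed c w (C⊆H c c∈C) (W⊆H w w∈W)

  Fragment : Subset n → Set
  Fragment C = C ⊆ H × 0 < card C × card (C +ₛ W) < card H

  -- X minimises |X + W| - |X| among fragments, and |X| among the minimisers.
  IsAtom : Subset n → Set
  IsAtom X = ∀ D → Fragment D →
    (card (X +ₛ W) + card D ≤ card (D +ₛ W) + card X) ×
    (card (D +ₛ W) + card X ≤ card (X +ₛ W) + card D → card X ≤ card D)

  -- Compare X with the fragment D = -(H ∖ (X + W)), for which D + W ⊆ H ∖ (-X).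
  atom-complement-bound : ∀ {X} → Fragment X → IsAtom X → card X + card (X +ₛ W) ≤ card H
  atom-complement-bound {X} (X⊆H , |X|>0 , |X+W|<|H|) X-atom = begin
    card X + card (X +ₛ W)  ≤⟨ +-monoˡ-≤ (card (X +ₛ W)) |X|≤|D| ⟩
    card D + card (X +ₛ W)  ≡⟨ |D|+|X+W|≡|H| ⟩
    card H                  ∎
    where
    open ≤-Reasoning
    D E : Subset n
    D z = H (⊖ z) ∧ not ((X +ₛ W) (⊖ z))
    E z = H z ∧ not (X (⊖ z))
    |D|+|X+W|≡|H| : card D + card (X +ₛ W) ≡ card H
    |D|+|X+W|≡|H| = trans (cong (_+ card (X +ₛ W)) (card-negate (λ z → H z ∧ not ((X +ₛ W) z))))
                          (card-∖ (+W⊆H X⊆H))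
    |E|+|X|≡|H| : card E + card X ≡ card H
    |E|+|X|≡|H| = trans (cong (card E +_) (sym (card-negate X)))
                        (card-∖ (λ z ⊖z∈X → ⊖-closed⁻¹ z (X⊆H (⊖ z) ⊖z∈X)))
    D+W⊆E : (D +ₛ W) ⊆ E
    D+W⊆E z z∈ with +ₛ-elim {S = D} {W} z∈
    ... | u , w , u∈D , w∈W , refl =
      ∧-intro (⊕-closed u w (⊖-closed⁻¹ u (∧-conicalˡ _ _ u∈D)) (W⊆H w w∈W)) (not-intro ⊖u∉X+W)
      where
      ⊖u∉X+W : X (⊖ (u ⊕ w)) ≡ true → ⊥
      ⊖u∉X+W ⊖[u⊕w]∈X = not-elim (∧-conicalʳ _ _ u∈D)
        (subst (_∈ₛ (X +ₛ W)) (trans (cong (_⊕ w) (sym (⁻¹-∙-comm u w))) (//-rightDividesˡ w (⊖ u)))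
          (+ₛ-intro {S = X} {W} ⊖[u⊕w]∈X w∈W))
    |D+W|≤|E| : card (D +ₛ W) ≤ card E
    |D+W|≤|E| = card-mono D+W⊆E
    D-fragment : Fragment D
    D-fragment = (λ z z∈D → ⊖-closed⁻¹ z (∧-conicalˡ _ _ z∈D))
               , +-cancelʳ-< (card (X +ₛ W)) 0 (card D) (subst (card (X +ₛ W) <_) (sym |D|+|X+W|≡|H|) |X+W|<|H|)
               , <-≤-trans (≤-<-trans |D+W|≤|E| (m<m+n (card E) |X|>0)) (≤-reflexive |E|+|X|≡|H|)
    |X|≤|D| : card X ≤ card D
    |X|≤|D| = proj₂ (X-atom D D-fragment) (begin
      card (D +ₛ W) + card X  ≤⟨ +-monoˡ-≤ (card X) |D+W|≤|E| ⟩
      card E + card X         ≡⟨ trans |E|+|X|≡|H| (sym |D|+|X+W|≡|H|) ⟩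
      card D + card (X +ₛ W)  ≡⟨ +-comm (card D) _ ⟩
      card (X +ₛ W) + card D  ∎)

  -- By submodularity, I = X ∩ (X - x) is as good as X, so minimality of |X| forces X ⊆ X - x.
  atom-+-closed : ∀ {X} → Fragment X → IsAtom X → 𝟘 ∈ₛ X → ∀ {x y} → x ∈ₛ X → y ∈ₛ X → (y ⊕ x) ∈ₛ X
  atom-+-closed {X} X-fragment@(X⊆H , _ , |X+W|<|H|) X-atom 𝟘∈X {x} {y} x∈X y∈X with X (y ⊕ x) in y⊕x∈?X
  ... | true  = refl
  ... | false = contradiction |X∖F|≡0 (>⇒≢ (card-pos X∖F y∈X∖F))
    where
    F I U X∖F : Subset n
    F z = X (z ⊕ x)
    I z = X z ∧ F z
    U z = X z ∨ F z
    X∖F z = X z ∧ not (F z)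
    y∈X∖F : y ∈ₛ X∖F
    y∈X∖F = ∧-intro y∈X (cong not y⊕x∈?X)
    |U|+|I|≡ : card U + card I ≡ card X + card X
    |U|+|I|≡ = trans (count-∨+count-∧ X F (elems n)) (cong (card X +_) (card-translate X x))
    |U+W|+|I+W|≤ : card (U +ₛ W) + card (I +ₛ W) ≤ card (X +ₛ W) + card (X +ₛ W)
    |U+W|+|I+W|≤ = ≤-trans (card-+ₛ-submodular X F W)
                           (≤-reflexive (cong (card (X +ₛ W) +_) (card-+ₛ-translate X W x)))
    I-fragment : Fragment I
    I-fragment = (λ z z∈I → X⊆H z (∧-conicalˡ _ _ z∈I))
               , card-pos I (∧-intro 𝟘∈X (subst (_∈ₛ X) (sym (⊕-identityˡ x)) x∈X))
               , ≤-<-trans (card-mono (+ₛ-monoˡ W λ z → ∧-conicalˡ _ _)) |X+W|<|H|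
    |X|≤|I| : card X ≤ card I
    |X|≤|I| with card (U +ₛ W) <? card H
    ... | yes |U+W|<|H| = proj₂ (X-atom I I-fragment)
      (submodular-step {card (X +ₛ W)} {card X} {card U} {card I} {card (U +ₛ W)} {card (I +ₛ W)}
        |U|+|I|≡ |U+W|+|I+W|≤ (proj₁ (X-atom U U-fragment)))
      where
      U⊆H : U ⊆ H
      U⊆H z z∈U with X z in z∈?X
      ... | true  = X⊆H z z∈?X
      ... | false = ⊕-cancel (X⊆H x x∈X) (X⊆H (z ⊕ x) z∈U)
      U-fragment : Fragment U
      U-fragment = U⊆H
                 , ≤-trans (proj₁ (proj₂ X-fragment)) (card-mono {S = X} {U} λ z z∈X → cong (_∨ F z) z∈X)
                 , |U+W|<|H|
    ... | no  |U+W|≮|H| = ⊥-elim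
      (submodular-absurd {card H} {card (X +ₛ W)} {card X} {card I} {card (U +ₛ W)} {card (I +ₛ W)}
      (≮⇒≥ |U+W|≮|H|) |U+W|+|I+W|≤ (proj₁ (X-atom I I-fragment)) (atom-complement-bound X-fragment X-atom)
      (proj₁ (proj₂ I-fragment)))
    |X∖F|≡0 : card X∖F ≡ 0
    |X∖F|≡0 = n≤0⇒n≡0 (+-cancelˡ-≤ (card I) (card X∖F) 0 (begin
      card I + card X∖F  ≡⟨ count-∧+count-∧not X F (elems n) ⟩
      card X             ≤⟨ |X|≤|I| ⟩
      card I             ≡⟨ +-identityʳ (card I) ⟨
      card I + 0         ∎))
      where open ≤-Reasoning

  module Expansion (m : ℕ) (|H|≡5^m : card H ≡ 5 ^ m) (W-large : 2 * card H < 5 * card W) where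

    Expanding : Subset n → Set
    Expanding C = 5 * card C + 2 * card H ≤ 5 * card (C +ₛ W)

    W-nonempty : ∃ λ w → w ∈ₛ W
    W-nonempty = card-witness W (*-cancelˡ-< 5 0 (card W) (≤-<-trans z≤n W-large))

    |C|≤|C+W| : ∀ C → card C ≤ card (C +ₛ W)
    |C|≤|C+W| C = card-≤-+ₛ C {W} (proj₂ W-nonempty)

    subgroup-expanding : ∀ {X} → IsSubgroup X → X ⊆ H → card (X +ₛ W) < card H → Expanding X
    subgroup-expanding {X} X-subgroup X⊆H |X+W|<|H| =
      multiples-gap (X.card-∣-periodic (X.+ₛ-periodic W)) 5|X|∣|H| (≤-trans W-large (*-monoʳ-≤ 5 |W|≤|X+W|))
      where
      module X = Subgroup X-subgroup
      |W|≤|X+W| : card W ≤ card (X +ₛ W)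
      |W|≤|X+W| = card-≤-+ₛʳ W X.𝟘∈K
      |X|∣|H| : card X ∣ card H
      |X|∣|H| = X.card-∣-periodic λ z k z∈H k∈X → ⊕-closed z k z∈H (X⊆H k k∈X)
      5|X|∣|H| : 5 * card X ∣ card H
      5|X|∣|H| = subst (5 * card X ∣_) (sym |H|≡5^m) (*-∣-prime-power prime[5] m (subst (card X ∣_) |H|≡5^m |X|∣|H|)
        (subst (card X <_) |H|≡5^m (≤-<-trans (|C|≤|C+W| X) |X+W|<|H|)))

    atom-expanding : ∀ {X} → Fragment X → IsAtom X → 𝟘 ∈ₛ X → Expanding X
    atom-expanding X-fragment@(X⊆H , _ , |X+W|<|H|) X-atom 𝟘∈X =
      subgroup-expanding (+-closed⇒subgroup 𝟘∈X λ x y x∈X y∈X → atom-+-closed X-fragment X-atom 𝟘∈X y∈X x∈X)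
        X⊆H |X+W|<|H|

    δ : Subset n → ℕ
    δ C = card (C +ₛ W) ∸ card C

    _≺_ : Subset n → Subset n → Set
    D ≺ C = ×-Lex _≡_ _<_ _<_ (δ D , card D) (δ C , card C)

    ≺-wellFounded : WellFounded _≺_
    ≺-wellFounded = On.wellFounded (λ C → δ C , card C) (×-wellFounded <-wellFounded <-wellFounded)

    minimal⇒atom : ∀ {C} → (∀ {D} → D ≺ C → Fragment D → Expanding D) → ¬ Expanding C → IsAtom C
    minimal⇒atom {C} ≺C⇒expanding C-not-expanding D D-fragment =
      lex-minimal {card (C +ₛ W)} {card C} {card (D +ₛ W)} {card D} (|C|≤|C+W| C) (|C|≤|C+W| D) λ D≺C →
        expansion-comparison {card H} {card (C +ₛ W)} {card C} {card (D +ₛ W)} {card D}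
          (≺C⇒expanding D≺C D-fragment) (≰⇒> C-not-expanding)

    module _ (C : Subset n) {c} (c∈C : c ∈ₛ C) where

      C-c : Subset n
      C-c z = C (z ⊕ c)

      fragment-translate : Fragment C → Fragment C-c
      fragment-translate (C⊆H , |C|>0 , |C+W|<|H|) =
        (λ z z⊕c∈C → ⊕-cancel (C⊆H c c∈C) (C⊆H (z ⊕ c) z⊕c∈C)) ,
        subst (0 <_) (sym (card-translate C c)) |C|>0 ,
        subst (_< card H) (sym (card-+ₛ-translate C W c)) |C+W|<|H|

      atom-translate : IsAtom C → IsAtom C-c
      atom-translate C-atom D D-fragment =
        subst₂ (λ b s → (b + card D ≤ card (D +ₛ W) + s) × (card (D +ₛ W) + s ≤ b + card D → s ≤ card D))
          (sym (card-+ₛ-translate C W c)) (sym (card-translate C c)) (C-atom D D-fragment)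

      expanding-translate : Expanding C-c → Expanding C
      expanding-translate = subst₂ (λ s b → 5 * s + 2 * card H ≤ 5 * b) (card-translate C c) (card-+ₛ-translate C W c)

      𝟘∈C-c : 𝟘 ∈ₛ C-c
      𝟘∈C-c = subst (_∈ₛ C) (sym (⊕-identityˡ c)) c∈C

    -- Well-founded induction on (|C + W| - |C|, |C|): a fragment that does not expand, while
    -- all smaller ones do, is an atom; its translate through 0 is then a subgroup, which expands.
    expanding : ∀ C → Fragment C → Expanding C
    expanding = All.wfRec ≺-wellFounded _ (λ C → Fragment C → Expanding C) step
      where
      step : ∀ C → (∀ {D} → D ≺ C → Fragment D → Expanding D) → Fragment C → Expanding C
      step C ≺C⇒expanding C-fragment with 5 * card C + 2 * card H ≤? 5 * card (C +ₛ W)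
      ... | yes C-expanding     = C-expanding
      ... | no  C-not-expanding = expanding-translate C c∈C
              (atom-expanding (fragment-translate C c∈C C-fragment)
                (atom-translate C c∈C (minimal⇒atom ≺C⇒expanding C-not-expanding)) (𝟘∈C-c C c∈C))
        where
        c∈C : proj₁ (card-witness C (proj₁ (proj₂ C-fragment))) ∈ₛ C
        c∈C = proj₂ (card-witness C (proj₁ (proj₂ C-fragment)))


fragment-bound : ∀ {x z b M} → x + b ≤ M → 5 * z + 2 * M ≤ 5 * b → 5 * x + 5 * z ≤ 3 * M
fragment-bound {x} {z} {b} {M} x+b≤M 5z+2M≤5b = +-cancelʳ-≤ (2 * M) _ _ (begin
  5 * x + 5 * z + 2 * M    ≡⟨ +-assoc (5 * x) (5 * z) (2 * M) ⟩
  5 * x + (5 * z + 2 * M)  ≤⟨ +-monoʳ-≤ (5 * x) 5z+2M≤5b ⟩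
  5 * x + 5 * b            ≡⟨ *-distribˡ-+ 5 x b ⟨
  5 * (x + b)              ≤⟨ *-monoʳ-≤ 5 x+b≤M ⟩
  5 * M                    ≡⟨ *-distribʳ-+ M 3 2 ⟩
  3 * M + 2 * M            ∎)
  where open ≤-Reasoning

empty-bound : ∀ {x b M} → x + b ≤ M → M ≤ b → 2 * M < 5 * x → ⊥
empty-bound {zero}  _     _   2M<0 = contradiction 2M<0 λ ()
empty-bound {suc x} {b} x+b≤M M≤b _ = contradiction (≤-trans x+b≤M M≤b) (m+1+n≰m b ∘ subst (_≤ b) (+-comm (suc x) b))

-- Z - Y misses X, and by expansion it has at least |Z| + 2|H|/5 elements unless it is all of H.
three-set-bound : ∀ {n} {H : Subset n} → IsSubgroup H → ∀ m → card H ≡ 5 ^ m →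
  ∀ {X Y Z} → X ⊆ H → Y ⊆ H → Z ⊆ H → 0 < card Z → (∀ x y → x ∈ₛ X → y ∈ₛ Y → Z (x ⊕ y) ≡ false) →
  2 * card H < 5 * card X → 2 * card H < 5 * card Y → 5 * card X + 5 * card Z ≤ 3 * card H
three-set-bound {n} {H} H-subgroup m |H|≡5^m {X} {Y} {Z} X⊆H Y⊆H Z⊆H |Z|>0 X+Y∩Z≡∅ X-large Y-large =
  case card (Z +ₛ W) <? card H of λ
    { (yes |Z-Y|<|H|) → fragment-bound {card X} {card Z} {card (Z +ₛ W)} |X|+|Z-Y|≤|H|
                          (expanding Z (Z⊆H , |Z|>0 , |Z-Y|<|H|))
    ; (no  |Z-Y|≮|H|) → ⊥-elim (empty-bound {card X} {card (Z +ₛ W)} |X|+|Z-Y|≤|H| (≮⇒≥ |Z-Y|≮|H|) X-large)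
    }
  where
  open Subgroup H-subgroup using (⊖-closed⁻¹)
  W : Subset n
  W z = Y (⊖ z)
  W⊆H : W ⊆ H
  W⊆H z ⊖z∈Y = ⊖-closed⁻¹ z (Y⊆H (⊖ z) ⊖z∈Y)
  open Isoperimetry H-subgroup W⊆H
  open Expansion m |H|≡5^m (subst (λ w → 2 * card H < 5 * w) (sym (card-negate Y)) Y-large)
  X∩[Z-Y]≡∅ : ∀ x → x ∈ₛ X → x ∈ₛ (Z +ₛ W) → ⊥
  X∩[Z-Y]≡∅ x x∈X x∈Z-Y with +ₛ-elim {S = Z} {W} x∈Z-Y
  ... | z , w , z∈Z , ⊖w∈Y , refl = contradiction
    (trans (sym z∈Z) (subst (λ v → Z v ≡ false) (//-rightDividesʳ w z) (X+Y∩Z≡∅ _ _ x∈X ⊖w∈Y))) λ ()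
  |X|+|Z-Y|≤|H| : card X + card (Z +ₛ W) ≤ card H
  |X|+|Z-Y|≤|H| = card-disjoint-∪ X⊆H (+W⊆H Z⊆H) X∩[Z-Y]≡∅


-- Cosets of a maximal subgroup

less-than-half : ∀ {x M} → 2 * x < M → 5 * x + 5 * 0 ≤ 3 * M
less-than-half {x} {M} 2x<M = *-cancelˡ-≤ 2 (begin
  2 * (5 * x + 5 * 0)  ≡⟨ cong (2 *_) (+-identityʳ (5 * x)) ⟩
  2 * (5 * x)          ≡⟨ ℕ*.x∙yz≈y∙xz 2 5 x ⟩
  5 * (2 * x)          ≤⟨ *-monoʳ-≤ 5 (<⇒≤ 2x<M) ⟩
  5 * M                ≤⟨ *-monoˡ-≤ M {5} {6} (n≤1+n 5) ⟩
  6 * M                ≡⟨ *-assoc 2 3 M ⟩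
  2 * (3 * M)          ∎)
  where open ≤-Reasoning

two-large-absurd : ∀ {x y M} → 2 * M < 5 * x → 2 * M < 5 * y → 5 * x + 5 * y ≤ 3 * M → ⊥
two-large-absurd {x} {y} {M} x-large y-large 5x+5y≤3M = m+1+n≰m (3 * M) (begin
  3 * M + suc (M + 1)          ≡⟨ rearrange M ⟩
  suc (2 * M) + suc (2 * M)    ≤⟨ +-mono-≤ x-large y-large ⟩
  5 * x + 5 * y                ≤⟨ 5x+5y≤3M ⟩
  3 * M                        ∎)
  where
  open ≤-Reasoning
  rearrange : ∀ M → 3 * M + suc (M + 1) ≡ suc (2 * M) + suc (2 * M)
  rearrange = solve-∀

five-slices-absurd : ∀ {a₀ a₁ a₂ a₃ a₄ s M} → s ≤ a₀ + (a₁ + (a₂ + (a₃ + (a₄ + 0)))) → 3 * M < 2 * s →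
  2 * M < 5 * a₂ → 5 * a₂ + 5 * a₄ ≤ 3 * M → 5 * a₃ + 5 * a₁ ≤ 3 * M → 5 * a₂ + 5 * a₀ ≤ 3 * M → ⊥
five-slices-absurd {a₀} {a₁} {a₂} {a₃} {a₄} {s} {M} s≤S s-large a₂-large b₂₄ b₃₁ b₂₀ =
  m+n≮n M (18 * M) (begin-strict
  M + 18 * M                    ≡⟨ nineteen M ⟩
  5 * (3 * M) + 2 * (2 * M)     <⟨ +-monoˡ-< (2 * (2 * M)) (*-monoʳ-< 5 s-large) ⟩
  5 * (2 * s) + 2 * (2 * M)     ≡⟨ cong (_+ 2 * (2 * M)) (ℕ*.x∙yz≈y∙xz 5 2 s) ⟩
  2 * (5 * s) + 2 * (2 * M)     ≤⟨ +-monoˡ-≤ (2 * (2 * M)) (*-monoʳ-≤ 2 (*-monoʳ-≤ 5 s≤S)) ⟩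
  2 * (5 * S) + 2 * (2 * M)     <⟨ +-monoʳ-< (2 * (5 * S)) (*-monoʳ-< 2 a₂-large) ⟩
  2 * (5 * S) + 2 * (5 * a₂)    ≡⟨ *-distribˡ-+ 2 (5 * S) (5 * a₂) ⟨
  2 * (5 * S + 5 * a₂)          ≡⟨ cong (2 *_) (regroup a₀ a₁ a₂ a₃ a₄) ⟩
  2 * ((5 * a₂ + 5 * a₄) + ((5 * a₃ + 5 * a₁) + (5 * a₂ + 5 * a₀)))
                                ≤⟨ *-monoʳ-≤ 2 (+-mono-≤ b₂₄ (+-mono-≤ b₃₁ b₂₀)) ⟩
  2 * (3 * M + (3 * M + 3 * M)) ≡⟨ eighteen M ⟩
  18 * M                        ∎)
  where
  open ≤-Reasoning
  S : ℕ
  S = a₀ + (a₁ + (a₂ + (a₃ + (a₄ + 0))))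
  nineteen : ∀ M → M + 18 * M ≡ 5 * (3 * M) + 2 * (2 * M)
  nineteen = solve-∀
  eighteen : ∀ M → 2 * (3 * M + (3 * M + 3 * M)) ≡ 18 * M
  eighteen = solve-∀
  regroup : ∀ a₀ a₁ a₂ a₃ a₄ → 5 * (a₀ + (a₁ + (a₂ + (a₃ + (a₄ + 0))))) + 5 * a₂ ≡
                                (5 * a₂ + 5 * a₄) + ((5 * a₃ + 5 * a₁) + (5 * a₂ + 5 * a₀))
  regroup = solve-∀


module CosetCount {n} {H : Subset n} (H-subgroup : IsSubgroup H) (A : Subset n) where

  open Subgroup H-subgroup using (⊖-closed; ∈-⊕-invariant)

  cosetCount-translate : ∀ g {h} → h ∈ₛ H → cosetCount A H (g ⊕ h) ≡ cosetCount A H g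
  cosetCount-translate g {h} h∈H = trans (sym (card-translate _ (⊖ h))) (count-cong shift (elems n))
    where
    shift : ∀ u → H (u ⊕ (⊖ h)) ∧ A ((g ⊕ h) ⊕ (u ⊕ (⊖ h))) ≡ H u ∧ A (g ⊕ u)
    shift u = cong₂ _∧_ (∈-⊕-invariant (⊖-closed h h∈H)) (cong A (begin
      (g ⊕ h) ⊕ (u ⊕ (⊖ h))  ≡⟨ interchange g h u (⊖ h) ⟩
      (g ⊕ u) ⊕ (h ⊕ (⊖ h))  ≡⟨ cong ((g ⊕ u) ⊕_) (⊕-inverseʳ h) ⟩
      (g ⊕ u) ⊕ 𝟘            ≡⟨ ⊕-identityʳ (g ⊕ u) ⟩
      g ⊕ u                  ∎))
      where open ≡-Reasoning

  card-∩-coset : ∀ x → card (λ g → A g ∧ H (g ⊕ (⊖ x))) ≡ cosetCount A H x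
  card-∩-coset x = trans (sym (card-translate _ x)) (count-cong shift (elems n))
    where
    shift : ∀ u → A (u ⊕ x) ∧ H ((u ⊕ x) ⊕ (⊖ x)) ≡ H u ∧ A (x ⊕ u)
    shift u = trans (cong₂ _∧_ (cong A (⊕-comm u x)) (cong H (//-rightDividesʳ x u))) (∧-comm (A (x ⊕ u)) (H u))

module MaximalSubgroup {m} {H : Subset (suc m)} (H-maximal : IsMaximalProperSubgroup H) {d} (d∉H : H d ≡ false) where

  H-subgroup : IsSubgroup H
  H-subgroup = proj₁ H-maximal

  open Subgroup H-subgroup using (𝟘∈K; ⊕-closed; card-∣-periodic)

  coset : ℕ → Subset (suc m)
  coset k g = H (g ⊕ (⊖ (k · d)))

  coset-0 : ∀ g → coset 0 g ≡ H g
  coset-0 g = cong H (trans (cong (g ⊕_) ε⁻¹≈ε) (⊕-identityʳ g))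

  coset-% : ∀ k g → coset k g ≡ coset (k % 5) g
  coset-% k g = cong (λ x → H (g ⊕ (⊖ x))) (k·x≡[k%5]·x k d)

  coset-+ : ∀ i j {g h} → g ∈ₛ coset i → h ∈ₛ coset j → (g ⊕ h) ∈ₛ coset (i + j)
  coset-+ i j {g} {h} g∈ h∈ = subst (_∈ₛ H) g⊕h-shift (⊕-closed _ _ g∈ h∈)
    where
    g⊕h-shift : (g ⊕ (⊖ (i · d))) ⊕ (h ⊕ (⊖ (j · d))) ≡ (g ⊕ h) ⊕ (⊖ ((i + j) · d))
    g⊕h-shift = begin
      (g ⊕ (⊖ (i · d))) ⊕ (h ⊕ (⊖ (j · d)))  ≡⟨ interchange g _ h _ ⟩
      (g ⊕ h) ⊕ ((⊖ (i · d)) ⊕ (⊖ (j · d)))  ≡⟨ cong ((g ⊕ h) ⊕_) (⁻¹-∙-comm (i · d) (j · d)) ⟩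
      (g ⊕ h) ⊕ (⊖ ((i · d) ⊕ (j · d)))      ≡⟨ cong (λ x → (g ⊕ h) ⊕ (⊖ x)) (×-homo-+ d i j) ⟨
      (g ⊕ h) ⊕ (⊖ ((i + j) · d))            ∎
      where open ≡-Reasoning

  H+⟨d⟩ : Subset (suc m)
  H+⟨d⟩ g = any (λ k → coset k g) (upTo 5)

  ∈H+⟨d⟩ : ∀ k {g} → g ∈ₛ coset k → g ∈ₛ H+⟨d⟩
  ∈H+⟨d⟩ k {g} g∈ = any-intro (λ k → coset k g) (∈-upTo⁺ (m%n<n k 5)) (trans (sym (coset-% k g)) g∈)

  H+⟨d⟩-subgroup : IsSubgroup H+⟨d⟩
  H+⟨d⟩-subgroup = +-closed⇒subgroup (∈H+⟨d⟩ 0 (trans (coset-0 𝟘) 𝟘∈K)) λ g h g∈ h∈ →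
    let (i , _ , g∈i) = any-witness (λ k → coset k g) (upTo 5) g∈
        (j , _ , h∈j) = any-witness (λ k → coset k h) (upTo 5) h∈
    in ∈H+⟨d⟩ (i + j) (coset-+ i j g∈i h∈j)

  d∈coset1 : d ∈ₛ coset 1
  d∈coset1 = subst (_∈ₛ H) (sym (trans (cong (λ x → d ⊕ (⊖ x)) (⊕-identityʳ d)) (⊕-inverseʳ d))) 𝟘∈K

  -- H+⟨d⟩ is a subgroup containing H and d ∉ H, so it is everything by maximality.
  H+⟨d⟩-everything : ∀ g → g ∈ₛ H+⟨d⟩
  H+⟨d⟩-everything = [ (λ H+⟨d⟩≗H → ⊥-elim (d∉H+⟨d⟩ H+⟨d⟩≗H)) , (λ everything → everything) ]′
    (proj₂ (proj₂ H-maximal) H+⟨d⟩ H+⟨d⟩-subgroup (λ g g∈H → ∈H+⟨d⟩ 0 (trans (coset-0 g) g∈H)))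
    where
    d∉H+⟨d⟩ : (∀ g → H+⟨d⟩ g ≡ H g) → ⊥
    d∉H+⟨d⟩ H+⟨d⟩≗H with () ← trans (sym (trans (sym (H+⟨d⟩≗H d)) (∈H+⟨d⟩ 1 d∈coset1))) d∉H

  covering : ∀ g → ∃ λ k → k ∈ upTo 5 × g ∈ₛ coset k
  covering g = any-witness (λ k → coset k g) (upTo 5) (H+⟨d⟩-everything g)

  card-coset : ∀ k → card (coset k) ≡ card H
  card-coset k = card-translate H (⊖ (k · d))

  |H|≡5^m : card H ≡ 5 ^ m
  |H|≡5^m = *-cancelˡ-≡ (card H) (5 ^ m) 5 (≤-antisym 5|H|≤5^[1+m] 5^[1+m]≤5|H|)
    where
    all : Subset (suc m)
    all _ = true
    5^[1+m]≤5|H| : 5 ^ suc m ≤ 5 * card H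
    5^[1+m]≤5|H| = begin
      5 ^ suc m                       ≡⟨ card-all (suc m) ⟨
      card all                        ≤⟨ card-≤-sum-cover all coset (upTo 5) (λ g _ → H+⟨d⟩-everything g) ⟩
      card (coset 0) + (card (coset 1) + (card (coset 2) + (card (coset 3) + (card (coset 4) + 0))))
                                      ≡⟨ cong₂ _+_ (card-coset 0) (cong₂ _+_ (card-coset 1) (cong₂ _+_ (card-coset 2)
                                           (cong₂ _+_ (card-coset 3) (cong (_+ 0) (card-coset 4))))) ⟩
      5 * card H                      ∎
      where open ≤-Reasoning
    |H|<5^[1+m] : card H < 5 ^ suc m
    |H|<5^[1+m] = begin-strict
      card H                          <⟨ m<n+m (card H) (card-pos (λ g → not (H g)) (cong not d∉H)) ⟩
      card (λ g → not (H g)) + card H ≡⟨ card-∖ {S = H} {all} (λ _ _ → refl) ⟩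
      card all                        ≡⟨ card-all (suc m) ⟩
      5 ^ suc m                       ∎
      where open ≤-Reasoning
    5|H|≤5^[1+m] : 5 * card H ≤ 5 ^ suc m
    5|H|≤5^[1+m] = ∣⇒≤ {{m^n≢0 5 (suc m)}} (*-∣-prime-power prime[5] (suc m)
      (subst (card H ∣_) (card-all (suc m)) (card-∣-periodic {S = all} λ _ _ _ _ → refl)) |H|<5^[1+m])

  module _ (A : Subset (suc m)) (A-sum-free : SumFree A) where

    open CosetCount H-subgroup A

    a : ℕ → ℕ
    a k = cosetCount A H (k · d)

    a-% : ∀ k → a k ≡ a (k % 5)
    a-% k = cong (cosetCount A H) (k·x≡[k%5]·x k d)

    cosetCount-coset : ∀ k {g} → g ∈ₛ coset k → cosetCount A H g ≡ a k
    cosetCount-coset k {g} g∈ = trans (cong (cosetCount A H) (sym (trans (⊕-comm _ _) (//-rightDividesˡ (k · d) g))))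
                                      (cosetCount-translate (k · d) g∈)

    |A|≤Σa : card A ≤ a 0 + (a 1 + (a 2 + (a 3 + (a 4 + 0))))
    |A|≤Σa = ≤-trans (card-≤-sum-cover A (λ k g → A g ∧ coset k g) (upTo 5) A-covered)
      (≤-reflexive (cong₂ _+_ (card-∩-coset (0 · d)) (cong₂ _+_ (card-∩-coset (1 · d))
        (cong₂ _+_ (card-∩-coset (2 · d)) (cong₂ _+_ (card-∩-coset (3 · d)) (cong (_+ 0) (card-∩-coset (4 · d))))))))
      where
      A-covered : ∀ g → g ∈ₛ A → any (λ k → A g ∧ coset k g) (upTo 5) ≡ true
      A-covered g g∈A = let (k , k∈ , g∈k) = covering g in any-intro (λ k → A g ∧ coset k g) k∈ (∧-intro g∈A g∈k)

    -- A ∩ (k·d + H), translated into H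
    A-slice : ℕ → Subset (suc m)
    A-slice k h = H h ∧ A ((k · d) ⊕ h)

    A-slice-sum-free : ∀ i j u v → u ∈ₛ A-slice i → v ∈ₛ A-slice j → A-slice (i + j) (u ⊕ v) ≡ false
    A-slice-sum-free i j u v u∈ v∈ = trans (cong (H (u ⊕ v) ∧_) (trans (cong A shift)
        (A-sum-free _ _ (∧-conicalʳ _ _ u∈) (∧-conicalʳ _ _ v∈)))) (∧-zeroʳ _)
      where
      shift : ((i + j) · d) ⊕ (u ⊕ v) ≡ ((i · d) ⊕ u) ⊕ ((j · d) ⊕ v)
      shift = trans (cong (_⊕ (u ⊕ v)) (×-homo-+ d i j)) (interchange (i · d) (j · d) u v)

    pair-bound : ∀ i j → 2 * card H < 5 * a i → 2 * card H < 5 * a j → 2 * a i < card H →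
                 5 * a i + 5 * a (i + j) ≤ 3 * card H
    pair-bound i j aᵢ-large aⱼ-large aᵢ-small = case 0 <? a (i + j) of λ
      { (yes aᵢ₊ⱼ>0) → three-set-bound H-subgroup m |H|≡5^m (λ _ → ∧-conicalˡ _ _) (λ _ → ∧-conicalˡ _ _)
                         (λ _ → ∧-conicalˡ _ _) aᵢ₊ⱼ>0 (A-slice-sum-free i j) aᵢ-large aⱼ-large
      ; (no  aᵢ₊ⱼ≯0) → subst (λ x → 5 * a i + 5 * x ≤ 3 * card H) (sym (n≤0⇒n≡0 (≮⇒≥ aᵢ₊ⱼ≯0)))
                          (less-than-half {a i} aᵢ-small)
      }

    module _ (A-large : 3 * 5 ^ m < 2 * card A) (cosets-small : ∀ g → 2 * cosetCount A H g < card H) where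

      small : ∀ k → 2 * a k < card H
      small k = cosets-small (k · d)

      ¬a₀-large : 2 * card H < 5 * a 0 → ⊥
      ¬a₀-large a₀-large = two-large-absurd {a 0} {a 0} {card H} a₀-large a₀-large
        (pair-bound 0 0 a₀-large a₀-large (small 0))

      ¬consecutive-large : ∀ {p} → p ∈ upTo 5 → 2 * card H < 5 * a p → 2 * card H < 5 * a (suc p) → ⊥
      ¬consecutive-large (here refl) a₀-large _ = ¬a₀-large a₀-large
      ¬consecutive-large (there (here refl)) a₁-large a₂-large =
        two-large-absurd {a 1} {a 2} {card H} a₁-large a₂-large (pair-bound 1 1 a₁-large a₁-large (small 1))
      -- a₂ + a₄, a₃ + a₁ and a₂ + a₀ are each at most 3|H|/5, but a₂ > 2|H|/5 and Σ a > 3|H|/2.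
      ¬consecutive-large (there (there (here refl))) a₂-large a₃-large =
        five-slices-absurd {a 0} {a 1} {a 2} {a 3} {a 4} {card A} {card H}
          |A|≤Σa (subst (λ M → 3 * M < 2 * card A) (sym |H|≡5^m) A-large) a₂-large
          (pair-bound 2 2 a₂-large a₂-large (small 2))
          (subst (λ x → 5 * a 3 + 5 * x ≤ 3 * card H) (a-% 6) (pair-bound 3 3 a₃-large a₃-large (small 3)))
          (subst (λ x → 5 * a 2 + 5 * x ≤ 3 * card H) (a-% 5) (pair-bound 2 3 a₂-large a₃-large (small 2)))
      ¬consecutive-large (there (there (there (here refl)))) a₃-large a₄-large =
        two-large-absurd {a 4} {a 3} {card H} a₄-large a₃-large
          (subst (λ x → 5 * a 4 + 5 * x ≤ 3 * card H) (a-% 8) (pair-bound 4 4 a₄-large a₄-large (small 4)))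
      ¬consecutive-large (there (there (there (there (here refl))))) _ a₅-large =
        ¬a₀-large (subst (λ x → 2 * card H < 5 * x) (a-% 5) a₅-large)

proposition3 : (m : ℕ) → (A H : Subset (suc m)) →
    SumFree A →
    3 * 5 ^ m < 2 * card A →
    IsMaximalProperSubgroup H →
    ((x : Z5^ (suc m)) → 2 * cosetCount A H x < card H) →
    (x y : Z5^ (suc m)) →
    2 * card H < 5 * cosetCount A H x →
    2 * card H < 5 * cosetCount A H y →
    SameCoset H x y
proposition3 m A H A-sum-free A-large H-maximal cosets-small x y x-large y-large with H (y ⊕ (⊖ x)) in y-x∈?H
... | true  = y ⊕ (⊖ x) , y-x∈?H , sym (trans (⊕-comm x _) (//-rightDividesˡ x y))
... | false = ⊥-elim (¬consecutive-large A A-sum-free A-large cosets-small p∈upTo5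
                (large {p} x∈coset x-large) (large {suc p} y∈coset y-large))
  where
  open MaximalSubgroup H-maximal {y ⊕ (⊖ x)} y-x∈?H
  p : ℕ
  p = proj₁ (covering x)
  p∈upTo5 : p ∈ upTo 5
  p∈upTo5 = proj₁ (proj₂ (covering x))
  x∈coset : x ∈ₛ coset p
  x∈coset = proj₂ (proj₂ (covering x))
  y∈coset : y ∈ₛ coset (suc p)
  y∈coset = subst (_∈ₛ coset (suc p)) (//-rightDividesˡ x y) (coset-+ 1 p d∈coset1 x∈coset)
  large : ∀ {k g} → g ∈ₛ coset k → 2 * card H < 5 * cosetCount A H g → 2 * card H < 5 * a A A-sum-free k
  large {k} g∈ = subst (λ c → 2 * card H < 5 * c) (cosetCount-coset A A-sum-free k g∈)
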